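{- For $n,m\ge3$ and $p\in(0,1)$, \begin{align*} n^2\|\bar g_2\ast_2^0\bar g_2\|_2^2&\lesssim(\operatorname{Var}[N_E])^2\frac{1}{n^2\hat p(1-\hat p)},\\ n^3\|\bar g_2\ast_2^1\bar g_2\|_2^2&\lesssim(\operatorname{Var}[N_E])^2\Big(\frac{1}{n^2\hat p(1-\hat p)}+\frac1n\Big), \end{align*} with absolute implied constants.
   Context: Random intersection graph $\mathcal G(n,m,p)$: $n$ vertices, $m$ attributes, each vertex chooses each attribute independently with probability $p$, vertices adjacent iff they share an attribute; $N_E$ is its number of edges and $\hat p=1-(1-p^2)^m$. $\mu_{m,p}(x)=p^{|x|}(1-p)^{m-|x|}$ on $\{0,1\}^m$. $g(x,y)=1$ iff $x_k=y_k=1$ for some $k$, else $0$; $\bar g_2(x,y)=g(x,y)-\hat p$. Contraction: $f\ast_b^ah(x_1,\dots,x_{b-a},y_1,\dots,y_{k-b},z_1,\dots,z_{l-b})=\int_{(\{0,1\}^m)^a}f(w,x,y)\,h(w,x,z)\,d\mu_{m,p}^{\otimes a}(w)$; thus $\|\bar g_2\ast_2^0\bar g_2\|_2^2=\iint\bar g_2^4$ and $\|\bar g_2\ast_2^1\bar g_2\|_2^2=\int\big(\int\bar g_2(x,y)^2d\mu_{m,p}(x)\big)^2d\mu_{m,p}(y)$.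
   Formalization: The parameter p ranges only over the rationals in (0,1), and the absolute implied constant is taken in ℚ. -}

module Defs where

open import Data.Nat as ℕ using (ℕ; zero; suc)
open import Data.Integer using (+_)
open import Data.Bool using (Bool; true; false; _∧_)
open import Data.Vec using (Vec; []; _∷_; foldr)
open import Data.List using (List; []; _∷_; map; concatMap)
open import Data.Rational using (ℚ; 0ℚ; 1ℚ; _+_; _*_; _-_; 1/_; _/_; ≢-nonZero)
open import Data.Rational.Properties using (_≟_)
open import Relation.Nullary using (yes; no)

ℕ→ℚ : ℕ → ℚ
ℕ→ℚ n = (+ n) / 1

_^_ : ℚ → ℕ → ℚ
x ^ zero = 1ℚ
x ^ suc k = x * (x ^ k)

-- total inverse: 1/x for x ≠ 0 (only ever applied to nonzero arguments below)
inv : ℚ → ℚ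
inv x with x ≟ 0ℚ
... | yes _ = 0ℚ
... | no x≢0 = 1/_ x {{≢-nonZero x≢0}}

sumℚ : List ℚ → ℚ
sumℚ [] = 0ℚ
sumℚ (x ∷ xs) = x + sumℚ xs

cube : (m : ℕ) → List (Vec Bool m)
cube zero = [] ∷ []
cube (suc m) = concatMap (λ v → (false ∷ v) ∷ (true ∷ v) ∷ []) (cube m)

weight : ∀ {m} → Vec Bool m → ℕ
weight [] = 0
weight (false ∷ x) = weight x
weight (true ∷ x) = suc (weight x)

μ : (m : ℕ) → ℚ → Vec Bool m → ℚ
μ m p x = (p ^ weight x) * ((1ℚ - p) ^ (m ℕ.∸ weight x))

∫ : (m : ℕ) → ℚ → (Vec Bool m → ℚ) → ℚ
∫ m p f = sumℚ (map (λ x → μ m p x * f x) (cube m))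

share : ∀ {m} → Vec Bool m → Vec Bool m → Bool
share [] [] = false
share (true ∷ x) (true ∷ y) = true
share (_ ∷ x) (_ ∷ y) = share x y

boolℚ : Bool → ℚ
boolℚ true = 1ℚ
boolℚ false = 0ℚ

g : ∀ {m} → Vec Bool m → Vec Bool m → ℚ
g x y = boolℚ (share x y)

phat : ℕ → ℚ → ℚ
phat m p = 1ℚ - ((1ℚ - p * p) ^ m)

gbar2 : (m : ℕ) → ℚ → Vec Bool m → Vec Bool m → ℚ
gbar2 m p x y = g x y - phat m p

contr20 : (m : ℕ) → ℚ → Vec Bool m → Vec Bool m → ℚ
contr20 m p x₁ x₂ = gbar2 m p x₁ x₂ * gbar2 m p x₁ x₂

contr21 : (m : ℕ) → ℚ → Vec Bool m → ℚ
contr21 m p x = ∫ m p (λ w → gbar2 m p w x * gbar2 m p w x)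

normSq20 : ℕ → ℚ → ℚ
normSq20 m p = ∫ m p (λ x₁ → ∫ m p (λ x₂ → contr20 m p x₁ x₂ * contr20 m p x₁ x₂))

normSq21 : ℕ → ℚ → ℚ
normSq21 m p = ∫ m p (λ x → contr21 m p x * contr21 m p x)

-- Random intersection graph G(n,m,p): a configuration assigns to each of the
-- n vertices its attribute vector in {0,1}^m; all entries independent Bernoulli(p).
configs : (n m : ℕ) → List (Vec (Vec Bool m) n)
configs zero m = [] ∷ []
configs (suc n) m = concatMap (λ c → map (λ x → x ∷ c) (cube m)) (configs n m)

prob : (n m : ℕ) → ℚ → Vec (Vec Bool m) n → ℚ
prob n m p c = foldr _ (λ x r → μ m p x * r) 1ℚ c

E : (n m : ℕ) → ℚ → (Vec (Vec Bool m) n → ℚ) → ℚ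
E n m p X = sumℚ (map (λ c → prob n m p c * X c) (configs n m))

NE : ∀ {n m} → Vec (Vec Bool m) n → ℚ
NE [] = 0ℚ
NE (x ∷ c) = foldr _ (λ y r → g x y + r) 0ℚ c + NE c

VarNE : (n m : ℕ) → ℚ → ℚ
VarNE n m p = E n m p (λ c → NE c * NE c) - (E n m p NE * E n m p NE)

{-# OPTIONS --safe #-}
module Submission where

-- Write ∫g(x) = ∫ g(x,y) dμ(y) and σ² = Var ∫g. As g is {0,1}-valued, ḡ₂² = (1 - 2p̂) g + p̂²
-- pointwise; hence ‖ḡ₂ ∗₂¹ ḡ₂‖² = (p̂(1 - p̂))² + (1 - 2p̂)² σ², and ḡ₂⁴ ≤ ḡ₂² gives
-- ‖ḡ₂ ∗₂⁰ ḡ₂‖² ≤ p̂(1 - p̂). Adding a vertex x to a configuration c adds Σ_{y ∈ c} g(x,y) edges,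
-- so integrating x out first turns the moments of N_E into recursions in n, which solve to
-- Var N_E = ½ n(n-1) p̂(1 - p̂) + n(n-1)(n-2) σ².
-- For n ≥ 3 this gives n² p̂(1 - p̂) ≤ 3 Var N_E and n³ σ² ≤ (9/2) Var N_E, and multiplying
-- these two bounds yields both inequalities with C = 27/2.

open import Defs
open import Data.Nat as ℕ using (ℕ)
open import Data.Rational using (ℚ; 0ℚ; 1ℚ; _+_; _*_; _-_; _≤_; _<_)
open import Data.Product using (Σ; _×_)

open import Algebra.Bundles using (CommutativeMonoid)
open import Data.Bool using (Bool; true; false)
import Data.Integer as ℤ
import Data.Integer.Properties as ℤ
open import Data.List using (List; []; _∷_; map; concatMap; _++_)
open import Data.List.Properties using (map-++; map-∘; map-cong)
open import Data.Nat using (zero; suc)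
import Data.Nat.Properties as ℕ
open import Data.Product using (_,_; proj₁; proj₂)
open import Data.Rational using (½; -_; _/_; 1/_; ≢-nonZero; nonNegative; positive; toℚᵘ)
open import Data.Rational.Properties as ℚ using (_≟_; +-*-commutativeRing)
import Data.Rational.Unnormalised as ℚᵘ
import Data.Rational.Unnormalised.Properties as ℚᵘ
open import Data.Sum using (inj₁; inj₂)
open import Data.Vec using (Vec; []; _∷_; foldr)
open import Relation.Binary.PropositionalEquality as ≡
  using (_≡_; refl; sym; trans; cong₂; subst; subst₂; module ≡-Reasoning)
open import Relation.Nullary using (yes; no; contradiction)
open import Relation.Nullary.Decidable using (dec⇒maybe)
open import Tactic.RingSolver using (solve-∀)
open import Tactic.RingSolver.Core.AlmostCommutativeRing using (AlmostCommutativeRing; fromCommutativeRing)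

open import Algebra.Properties.CommutativeSemigroup
  (CommutativeMonoid.commutativeSemigroup ℚ.+-0-commutativeMonoid) using (interchange)
open import Algebra.Properties.CommutativeSemigroup
  (CommutativeMonoid.commutativeSemigroup ℚ.*-1-commutativeMonoid) using (x∙yz≈y∙xz)

-- Arithmetic and order in ℚ

ℚ-ring : AlmostCommutativeRing _ _
ℚ-ring = fromCommutativeRing +-*-commutativeRing (λ x → dec⇒maybe (0ℚ ≟ x))

module _ {x y : ℚ} where

  +-nonNeg : 0ℚ ≤ x → 0ℚ ≤ y → 0ℚ ≤ x + y
  +-nonNeg = ℚ.+-mono-≤

  *-nonNeg : 0ℚ ≤ x → 0ℚ ≤ y → 0ℚ ≤ x * y
  *-nonNeg x≥0 y≥0 = ℚ.nonNegative⁻¹ (x * y) {{ℚ.nonNeg*nonNeg⇒nonNeg x {{nonNegative x≥0}} y {{nonNegative y≥0}}}}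

  *-pos : 0ℚ < x → 0ℚ < y → 0ℚ < x * y
  *-pos x>0 y>0 = ℚ.positive⁻¹ (x * y) {{ℚ.pos*pos⇒pos x {{positive x>0}} y {{positive y>0}}}}

^-nonNeg : ∀ {x} k → 0ℚ ≤ x → 0ℚ ≤ x ^ k
^-nonNeg zero    x≥0 = ℚ.nonNegative⁻¹ 1ℚ
^-nonNeg (suc k) x≥0 = *-nonNeg x≥0 (^-nonNeg k x≥0)

ℕ→ℚ-suc : ∀ n → ℕ→ℚ (suc n) ≡ 1ℚ + ℕ→ℚ n
ℕ→ℚ-suc n = ℚ.toℚᵘ-injective (begin
  toℚᵘ (ℕ→ℚ (suc n))               ≈⟨ ℚ.toℚᵘ-fromℚᵘ (ℚᵘ.mkℚᵘ (ℤ.+ suc n) 0) ⟩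
  ℚᵘ.mkℚᵘ (ℤ.+ suc n) 0               ≈⟨ ℚᵘ.*≡* (≡.cong (ℤ._* (ℤ.+ 1)) (≡.cong (ℤ._+_ (ℤ.+ 1)) (sym (ℤ.*-identityʳ (ℤ.+ n))))) ⟩
  toℚᵘ 1ℚ ℚᵘ.+ ℚᵘ.mkℚᵘ (ℤ.+ n) 0      ≈⟨ ℚᵘ.+-congʳ (toℚᵘ 1ℚ) (ℚᵘ.≃-sym (ℚ.toℚᵘ-fromℚᵘ (ℚᵘ.mkℚᵘ (ℤ.+ n) 0))) ⟩
  toℚᵘ 1ℚ ℚᵘ.+ toℚᵘ (ℕ→ℚ n)         ≈⟨ ℚᵘ.≃-sym (ℚ.toℚᵘ-homo-+ 1ℚ (ℕ→ℚ n)) ⟩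
  toℚᵘ (1ℚ + ℕ→ℚ n) ∎)
  where open ℚᵘ.≃-Reasoning

ℕ→ℚ-+ : ∀ a b → ℕ→ℚ (a ℕ.+ b) ≡ ℕ→ℚ a + ℕ→ℚ b
ℕ→ℚ-+ zero    b = sym (ℚ.+-identityˡ (ℕ→ℚ b))
ℕ→ℚ-+ (suc a) b = begin
  ℕ→ℚ (suc (a ℕ.+ b))           ≡⟨ ℕ→ℚ-suc (a ℕ.+ b) ⟩
  1ℚ + ℕ→ℚ (a ℕ.+ b)            ≡⟨ ≡.cong (1ℚ +_) (ℕ→ℚ-+ a b) ⟩
  1ℚ + (ℕ→ℚ a + ℕ→ℚ b)          ≡⟨ sym (ℚ.+-assoc 1ℚ (ℕ→ℚ a) (ℕ→ℚ b)) ⟩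
  (1ℚ + ℕ→ℚ a) + ℕ→ℚ b          ≡⟨ ≡.cong (_+ ℕ→ℚ b) (sym (ℕ→ℚ-suc a)) ⟩
  ℕ→ℚ (suc a) + ℕ→ℚ b ∎
  where open ≡-Reasoning

ℕ→ℚ-nonNeg : ∀ k → 0ℚ ≤ ℕ→ℚ k
ℕ→ℚ-nonNeg k = ℚ.nonNegative⁻¹ (ℕ→ℚ k) {{ℚ.normalize-nonNeg k 1}}

square-nonNeg : ∀ x → 0ℚ ≤ x * x
square-nonNeg x with ℚ.≤-total 0ℚ x
... | inj₁ x≥0 = *-nonNeg x≥0 x≥0
... | inj₂ x≤0 = subst (0ℚ ≤_) (neg*neg x) (*-nonNeg (ℚ.neg-antimono-≤ x≤0) (ℚ.neg-antimono-≤ x≤0))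
  where
  neg*neg : ∀ x → (- x) * (- x) ≡ x * x
  neg*neg = solve-∀ ℚ-ring

private
  x+[y-x]≡y : ∀ x y → x + (y - x) ≡ y
  x+[y-x]≡y = solve-∀ ℚ-ring

≤-by-difference : ∀ {x y} d → y - x ≡ d → 0ℚ ≤ d → x ≤ y
≤-by-difference {x} {y} d y-x≡d d≥0 =
  subst₂ _≤_ (ℚ.+-identityʳ x) (x+[y-x]≡y x y) (ℚ.+-monoʳ-≤ x (subst (0ℚ ≤_) (sym y-x≡d) d≥0))

<-by-difference : ∀ {x y} d → y - x ≡ d → 0ℚ < d → x < y
<-by-difference {x} {y} d y-x≡d d>0 =
  subst₂ _<_ (ℚ.+-identityʳ x) (x+[y-x]≡y x y) (ℚ.+-monoʳ-< x (subst (0ℚ <_) (sym y-x≡d) d>0))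

p<q⇒0<q-p : ∀ {p q} → p < q → 0ℚ < q - p
p<q⇒0<q-p {p} {q} p<q = subst (_< q - p) (ℚ.+-inverseʳ p) (ℚ.+-monoˡ-< (- p) p<q)

*-mono-≤-nonNeg : ∀ {a b c d} → 0ℚ ≤ a → a ≤ b → 0ℚ ≤ c → c ≤ d → a * c ≤ b * d
*-mono-≤-nonNeg {b = b} {c = c} a≥0 a≤b c≥0 c≤d =
  ℚ.≤-trans (ℚ.*-monoʳ-≤-nonNeg c {{nonNegative c≥0}} a≤b)
            (ℚ.*-monoˡ-≤-nonNeg b {{nonNegative (ℚ.≤-trans a≥0 a≤b)}} c≤d)

*≤⇒≤*inv : ∀ {x y z} → 0ℚ < z → x * z ≤ y → x ≤ y * inv z
*≤⇒≤*inv {x} {y} {z} z>0 xz≤y with z ≟ 0ℚ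
... | yes z≡0 = contradiction (subst (0ℚ <_) z≡0 z>0) (ℚ.<-irrefl refl)
... | no z≢0 = begin
  x                ≡⟨ sym (trans (ℚ.*-assoc x z z⁻¹) (trans (≡.cong (x *_) (ℚ.*-inverseʳ z {{≢-nonZero z≢0}})) (ℚ.*-identityʳ x))) ⟩
  (x * z) * z⁻¹    ≤⟨ ℚ.*-monoʳ-≤-nonNeg z⁻¹ {{ℚ.pos⇒nonNeg z⁻¹ {{ℚ.1/pos⇒pos z {{positive z>0}}}}}} xz≤y ⟩
  y * z⁻¹ ∎
  where
  open ℚ.≤-Reasoning
  z⁻¹ = (1/ z) {{≢-nonZero z≢0}}

^-pos : ∀ {x} k → 0ℚ < x → 0ℚ < x ^ k
^-pos zero    x>0 = ℚ.positive⁻¹ 1ℚ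
^-pos (suc k) x>0 = *-pos x>0 (^-pos k x>0)

^≤1 : ∀ {x} k → 0ℚ ≤ x → x ≤ 1ℚ → x ^ k ≤ 1ℚ
^≤1 zero    x≥0 x≤1 = ℚ.≤-refl
^≤1 (suc k) x≥0 x≤1 = *-mono-≤-nonNeg x≥0 x≤1 (^-nonNeg k x≥0) (^≤1 k x≥0 x≤1)

sumℚ-++ : ∀ xs ys → sumℚ (xs ++ ys) ≡ sumℚ xs + sumℚ ys
sumℚ-++ []       ys = sym (ℚ.+-identityˡ (sumℚ ys))
sumℚ-++ (x ∷ xs) ys = trans (≡.cong (x +_) (sumℚ-++ xs ys)) (sym (ℚ.+-assoc x (sumℚ xs) (sumℚ ys)))

sumℚ-map-concatMap : ∀ {A B : Set} (f : B → ℚ) (k : A → List B) xs →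
  sumℚ (map f (concatMap k xs)) ≡ sumℚ (map (λ a → sumℚ (map f (k a))) xs)
sumℚ-map-concatMap f k []       = refl
sumℚ-map-concatMap f k (a ∷ xs) = begin
  sumℚ (map f (k a ++ concatMap k xs))               ≡⟨ ≡.cong sumℚ (map-++ f (k a) (concatMap k xs)) ⟩
  sumℚ (map f (k a) ++ map f (concatMap k xs))       ≡⟨ sumℚ-++ (map f (k a)) _ ⟩
  sumℚ (map f (k a)) + sumℚ (map f (concatMap k xs)) ≡⟨ ≡.cong (sumℚ (map f (k a)) +_) (sumℚ-map-concatMap f k xs) ⟩
  sumℚ (map f (k a)) + sumℚ (map (λ a → sumℚ (map f (k a))) xs) ∎
  where open ≡-Reasoning

-- Finite expectations

module _ {A : Set} where

  -- Both ∫ m p and E n m p unfold to this form.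
  wsum : List A → (A → ℚ) → (A → ℚ) → ℚ
  wsum xs w f = sumℚ (map (λ x → w x * f x) xs)

  wsum-cong : ∀ xs w {f h : A → ℚ} → (∀ x → f x ≡ h x) → wsum xs w f ≡ wsum xs w h
  wsum-cong []       w f≗h = refl
  wsum-cong (x ∷ xs) w f≗h = cong₂ (λ a b → w x * a + b) (f≗h x) (wsum-cong xs w f≗h)

  wsum-+ : ∀ xs w (f h : A → ℚ) → wsum xs w (λ x → f x + h x) ≡ wsum xs w f + wsum xs w h
  wsum-+ []       w f h = refl
  wsum-+ (x ∷ xs) w f h =
    trans (cong₂ _+_ (ℚ.*-distribˡ-+ (w x) (f x) (h x)) (wsum-+ xs w f h))
          (interchange (w x * f x) (w x * h x) (wsum xs w f) (wsum xs w h))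

  wsum-* : ∀ xs w k (f : A → ℚ) → wsum xs w (λ x → k * f x) ≡ k * wsum xs w f
  wsum-* []       w k f = sym (ℚ.*-zeroʳ k)
  wsum-* (x ∷ xs) w k f =
    trans (cong₂ _+_ (x∙yz≈y∙xz (w x) k (f x)) (wsum-* xs w k f))
          (sym (ℚ.*-distribˡ-+ k (w x * f x) (wsum xs w f)))

  wsum-zero : ∀ xs (w : A → ℚ) → wsum xs w (λ _ → 0ℚ) ≡ 0ℚ
  wsum-zero []       w = refl
  wsum-zero (x ∷ xs) w = cong₂ _+_ (ℚ.*-zeroʳ (w x)) (wsum-zero xs w)

  wsum-mono : ∀ xs w {f h : A → ℚ} → (∀ x → 0ℚ ≤ w x) → (∀ x → f x ≤ h x) → wsum xs w f ≤ wsum xs w h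
  wsum-mono []       w w≥0 f≤h = ℚ.≤-refl
  wsum-mono (x ∷ xs) w w≥0 f≤h =
    ℚ.+-mono-≤ (ℚ.*-monoˡ-≤-nonNeg (w x) {{nonNegative (w≥0 x)}} (f≤h x)) (wsum-mono xs w w≥0 f≤h)

wsum-swap : ∀ {A B : Set} xs (v : A → ℚ) ys (w : B → ℚ) (F : A → B → ℚ) →
  wsum xs v (λ a → wsum ys w (F a)) ≡ wsum ys w (λ b → wsum xs v (λ a → F a b))
wsum-swap []       v ys w F = sym (wsum-zero ys w)
wsum-swap (a ∷ xs) v ys w F =
  trans (cong₂ _+_ (sym (wsum-* ys w (v a) (F a))) (wsum-swap xs v ys w F))
        (sym (wsum-+ ys w (λ b → v a * F a b) (λ b → wsum xs v (λ a → F a b))))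

record IsExpectation {A : Set} (𝔼 : (A → ℚ) → ℚ) : Set where
  field
    cong  : ∀ {f h} → (∀ x → f x ≡ h x) → 𝔼 f ≡ 𝔼 h
    +-hom : ∀ f h → 𝔼 (λ x → f x + h x) ≡ 𝔼 f + 𝔼 h
    *-hom : ∀ k f → 𝔼 (λ x → k * f x) ≡ k * 𝔼 f
    const : ∀ k → 𝔼 (λ _ → k) ≡ k

  +-const : ∀ f c → 𝔼 (λ x → f x + c) ≡ 𝔼 f + c
  +-const f c = trans (+-hom f (λ _ → c)) (≡.cong (𝔼 f +_) (const c))

  affine : ∀ k f c → 𝔼 (λ x → k * f x + c) ≡ k * 𝔼 f + c
  affine k f c = trans (+-const (λ x → k * f x) c) (≡.cong (_+ c) (*-hom k f))

  +-hom₄ : ∀ f₁ f₂ f₃ f₄ → 𝔼 (λ x → f₁ x + (f₂ x + (f₃ x + f₄ x))) ≡ 𝔼 f₁ + (𝔼 f₂ + (𝔼 f₃ + 𝔼 f₄))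
  +-hom₄ f₁ f₂ f₃ f₄ =
    trans (+-hom f₁ _) (≡.cong (𝔼 f₁ +_) (trans (+-hom f₂ _) (≡.cong (𝔼 f₂ +_) (+-hom f₃ f₄))))

  Var : (A → ℚ) → ℚ
  Var f = 𝔼 (λ x → f x * f x) - 𝔼 f * 𝔼 f

  *-shift : ∀ f h a b → 𝔼 (λ x → (f x + a) * (h x + b)) ≡ 𝔼 (λ x → f x * h x) + (𝔼 f * b + (𝔼 h * a + a * b))
  *-shift f h a b = begin
    𝔼 (λ x → (f x + a) * (h x + b))                         ≡⟨ cong (λ x → expand (f x) (h x) a b) ⟩
    𝔼 (λ x → f x * h x + (b * f x + (a * h x + a * b)))     ≡⟨ +-hom _ _ ⟩
    𝔼 (λ x → f x * h x) + 𝔼 (λ x → b * f x + (a * h x + a * b))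
      ≡⟨ ≡.cong (𝔼 (λ x → f x * h x) +_) (trans (+-hom _ _) (cong₂ _+_ (*-hom b f) (affine a h (a * b)))) ⟩
    𝔼 (λ x → f x * h x) + (b * 𝔼 f + (a * 𝔼 h + a * b))    ≡⟨ ≡.cong (𝔼 (λ x → f x * h x) +_) (commute (𝔼 f) (𝔼 h) a b) ⟩
    𝔼 (λ x → f x * h x) + (𝔼 f * b + (𝔼 h * a + a * b)) ∎
    where
    open ≡-Reasoning
    expand : ∀ y z a b → (y + a) * (z + b) ≡ y * z + (b * y + (a * z + a * b))
    expand = solve-∀ ℚ-ring
    commute : ∀ e e′ a b → b * e + (a * e′ + a * b) ≡ e * b + (e′ * a + a * b)
    commute = solve-∀ ℚ-ring

  Var≡𝔼[f-𝔼f]² : ∀ f → 𝔼 (λ x → (f x - 𝔼 f) * (f x - 𝔼 f)) ≡ Var f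
  Var≡𝔼[f-𝔼f]² f = trans (*-shift f f (- 𝔼 f) (- 𝔼 f)) (centre (𝔼 (λ x → f x * f x)) (𝔼 f))
    where
    centre : ∀ t e → t + (e * (- e) + (e * (- e) + (- e) * (- e))) ≡ t - e * e
    centre = solve-∀ ℚ-ring

wsum-isExpectation : ∀ {A : Set} xs (w : A → ℚ) → wsum xs w (λ _ → 1ℚ) ≡ 1ℚ → IsExpectation (wsum xs w)
wsum-isExpectation xs w total = record
  { cong  = wsum-cong xs w
  ; +-hom = wsum-+ xs w
  ; *-hom = wsum-* xs w
  ; const = λ k → begin
      wsum xs w (λ _ → k)          ≡⟨ wsum-cong xs w (λ _ → sym (ℚ.*-identityʳ k)) ⟩
      wsum xs w (λ _ → k * 1ℚ)     ≡⟨ wsum-* xs w k (λ _ → 1ℚ) ⟩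
      k * wsum xs w (λ _ → 1ℚ)     ≡⟨ ≡.cong (k *_) total ⟩
      k * 1ℚ                        ≡⟨ ℚ.*-identityʳ k ⟩
      k ∎
  }
  where open ≡-Reasoning

-- The product measure μ_{m,p}

weight≤length : ∀ {m} (v : Vec Bool m) → weight v ℕ.≤ m
weight≤length []          = ℕ.z≤n
weight≤length (false ∷ v) = ℕ.m≤n⇒m≤1+n (weight≤length v)
weight≤length (true ∷ v)  = ℕ.s≤s (weight≤length v)

μ-false : ∀ m p (v : Vec Bool m) → μ (suc m) p (false ∷ v) ≡ (1ℚ - p) * μ m p v
μ-false m p v = begin
  (p ^ weight v) * ((1ℚ - p) ^ (suc m ℕ.∸ weight v))  ≡⟨ ≡.cong (λ k → (p ^ weight v) * ((1ℚ - p) ^ k)) (ℕ.+-∸-assoc 1 (weight≤length v)) ⟩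
  (p ^ weight v) * ((1ℚ - p) * (1ℚ - p) ^ (m ℕ.∸ weight v)) ≡⟨ x∙yz≈y∙xz (p ^ weight v) (1ℚ - p) _ ⟩
  (1ℚ - p) * μ m p v ∎
  where open ≡-Reasoning

μ-true : ∀ m p (v : Vec Bool m) → μ (suc m) p (true ∷ v) ≡ p * μ m p v
μ-true m p v = ℚ.*-assoc p (p ^ weight v) ((1ℚ - p) ^ (m ℕ.∸ weight v))

μ-nonNeg : ∀ m {p} → 0ℚ ≤ p → 0ℚ ≤ 1ℚ - p → ∀ v → 0ℚ ≤ μ m p v
μ-nonNeg m p≥0 1-p≥0 v = *-nonNeg (^-nonNeg (weight v) p≥0) (^-nonNeg (m ℕ.∸ weight v) 1-p≥0)

∫-cons : ∀ m p (f : Vec Bool (suc m) → ℚ) →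
  ∫ (suc m) p f ≡ (1ℚ - p) * ∫ m p (λ v → f (false ∷ v)) + p * ∫ m p (λ v → f (true ∷ v))
∫-cons m p f = begin
  ∫ (suc m) p f
    ≡⟨ sumℚ-map-concatMap (λ x → μ (suc m) p x * f x) (λ v → (false ∷ v) ∷ (true ∷ v) ∷ []) (cube m) ⟩
  sumℚ (map (λ v → μ (suc m) p (false ∷ v) * f₀ v + (μ (suc m) p (true ∷ v) * f₁ v + 0ℚ)) (cube m))
    ≡⟨ ≡.cong sumℚ (map-cong split (cube m)) ⟩
  wsum (cube m) (μ m p) (λ v → (1ℚ - p) * f₀ v + p * f₁ v)
    ≡⟨ wsum-+ (cube m) (μ m p) _ _ ⟩
  wsum (cube m) (μ m p) (λ v → (1ℚ - p) * f₀ v) + wsum (cube m) (μ m p) (λ v → p * f₁ v)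
    ≡⟨ cong₂ _+_ (wsum-* (cube m) (μ m p) (1ℚ - p) f₀) (wsum-* (cube m) (μ m p) p f₁) ⟩
  (1ℚ - p) * ∫ m p f₀ + p * ∫ m p f₁ ∎
  where
  open ≡-Reasoning
  f₀ f₁ : Vec Bool m → ℚ
  f₀ v = f (false ∷ v)
  f₁ v = f (true ∷ v)
  factor : ∀ p u a b → ((1ℚ - p) * u) * a + ((p * u) * b + 0ℚ) ≡ u * ((1ℚ - p) * a + p * b)
  factor = solve-∀ ℚ-ring
  split : ∀ v → μ (suc m) p (false ∷ v) * f₀ v + (μ (suc m) p (true ∷ v) * f₁ v + 0ℚ)
              ≡ μ m p v * ((1ℚ - p) * f₀ v + p * f₁ v)
  split v = trans (cong₂ (λ a b → a * f₀ v + (b * f₁ v + 0ℚ)) (μ-false m p v) (μ-true m p v))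
                  (factor p (μ m p v) (f₀ v) (f₁ v))

∫-one : ∀ m p → ∫ m p (λ _ → 1ℚ) ≡ 1ℚ
∫-one zero    p = refl
∫-one (suc m) p = begin
  ∫ (suc m) p (λ _ → 1ℚ)                                     ≡⟨ ∫-cons m p (λ _ → 1ℚ) ⟩
  (1ℚ - p) * ∫ m p (λ _ → 1ℚ) + p * ∫ m p (λ _ → 1ℚ)        ≡⟨ ≡.cong (λ a → (1ℚ - p) * a + p * a) (∫-one m p) ⟩
  (1ℚ - p) * 1ℚ + p * 1ℚ                                     ≡⟨ total p ⟩
  1ℚ ∎
  where
  open ≡-Reasoning
  total : ∀ p → (1ℚ - p) * 1ℚ + p * 1ℚ ≡ 1ℚ
  total = solve-∀ ℚ-ring

∫-isExpectation : ∀ m p → IsExpectation (∫ m p)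
∫-isExpectation m p = wsum-isExpectation (cube m) (μ m p) (∫-one m p)

∫-mono : ∀ m {p} → 0ℚ ≤ p → 0ℚ ≤ 1ℚ - p → {f h : Vec Bool m → ℚ} → (∀ x → f x ≤ h x) → ∫ m p f ≤ ∫ m p h
∫-mono m p≥0 1-p≥0 = wsum-mono (cube m) _ (μ-nonNeg m p≥0 1-p≥0)

E-cons : ∀ n m p (F : Vec (Vec Bool m) (suc n) → ℚ) → E (suc n) m p F ≡ E n m p (λ c → ∫ m p (λ x → F (x ∷ c)))
E-cons n m p F = begin
  E (suc n) m p F
    ≡⟨ sumℚ-map-concatMap (λ c → prob (suc n) m p c * F c) (λ c → map (_∷ c) (cube m)) (configs n m) ⟩
  sumℚ (map (λ c → sumℚ (map (λ c′ → prob (suc n) m p c′ * F c′) (map (_∷ c) (cube m)))) (configs n m))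
    ≡⟨ ≡.cong sumℚ (map-cong (λ c → trans (≡.cong sumℚ (sym (map-∘ (cube m)))) (extend c)) (configs n m)) ⟩
  E n m p (λ c → ∫ m p (λ x → F (x ∷ c))) ∎
  where
  open ≡-Reasoning
  extend : ∀ c → sumℚ (map (λ x → (μ m p x * prob n m p c) * F (x ∷ c)) (cube m))
                 ≡ prob n m p c * ∫ m p (λ x → F (x ∷ c))
  extend c = trans (≡.cong sumℚ (map-cong (λ x → ℚ.*-assoc (μ m p x) (prob n m p c) (F (x ∷ c))) (cube m)))
                   (wsum-* (cube m) (μ m p) (prob n m p c) (λ x → F (x ∷ c)))

E-one : ∀ n m p → E n m p (λ _ → 1ℚ) ≡ 1ℚ
E-one zero    m p = refl
E-one (suc n) m p = trans (E-cons n m p (λ _ → 1ℚ)) (trans (wsum-cong (configs n m) (prob n m p) (λ _ → ∫-one m p)) (E-one n m p))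

E-isExpectation : ∀ n m p → IsExpectation (E n m p)
E-isExpectation n m p = wsum-isExpectation (configs n m) (prob n m p) (E-one n m p)

-- The kernel g and the contraction norms

share-sym : ∀ {m} (x y : Vec Bool m) → share x y ≡ share y x
share-sym []          []          = refl
share-sym (true ∷ x)  (true ∷ y)  = refl
share-sym (true ∷ x)  (false ∷ y) = share-sym x y
share-sym (false ∷ x) (true ∷ y)  = share-sym x y
share-sym (false ∷ x) (false ∷ y) = share-sym x y

g-sym : ∀ {m} (x y : Vec Bool m) → g x y ≡ g y x
g-sym x y = ≡.cong boolℚ (share-sym x y)

boolℚ-idem : ∀ b → boolℚ b * boolℚ b ≡ boolℚ b
boolℚ-idem true  = refl
boolℚ-idem false = refl

boolℚ-sub-sq : ∀ b a → (boolℚ b - a) * (boolℚ b - a) ≡ (1ℚ - (a + a)) * boolℚ b + a * a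
boolℚ-sub-sq true  = solve-∀ ℚ-ring
boolℚ-sub-sq false = solve-∀ ℚ-ring

boolℚ-sub⁴≤sq : ∀ b {a} → 0ℚ ≤ a → 0ℚ ≤ 1ℚ - a →
  ((boolℚ b - a) * (boolℚ b - a)) * ((boolℚ b - a) * (boolℚ b - a)) ≤ (boolℚ b - a) * (boolℚ b - a)
boolℚ-sub⁴≤sq true  {a} a≥0 1-a≥0 =
  ≤-by-difference _ (gap a) (*-nonNeg (*-nonNeg 1-a≥0 1-a≥0) (*-nonNeg a≥0 (+-nonNeg (ℚ.nonNegative⁻¹ 1ℚ) 1-a≥0)))
  where
  gap : ∀ a → (1ℚ - a) * (1ℚ - a) - ((1ℚ - a) * (1ℚ - a)) * ((1ℚ - a) * (1ℚ - a))
            ≡ ((1ℚ - a) * (1ℚ - a)) * (a * (1ℚ + (1ℚ - a)))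
  gap = solve-∀ ℚ-ring
boolℚ-sub⁴≤sq false {a} a≥0 1-a≥0 =
  ≤-by-difference _ (gap a) (*-nonNeg (*-nonNeg a≥0 a≥0) (*-nonNeg 1-a≥0 (+-nonNeg (ℚ.nonNegative⁻¹ 1ℚ) a≥0)))
  where
  gap : ∀ a → (0ℚ - a) * (0ℚ - a) - ((0ℚ - a) * (0ℚ - a)) * ((0ℚ - a) * (0ℚ - a))
            ≡ (a * a) * ((1ℚ - a) * (1ℚ + a))
  gap = solve-∀ ℚ-ring

∫g : (m : ℕ) → ℚ → Vec Bool m → ℚ
∫g m p x = ∫ m p (g x)

∫∫g≡phat : ∀ m p → ∫ m p (∫g m p) ≡ phat m p
∫∫g≡phat zero    p = refl
∫∫g≡phat (suc m) p = begin
  ∫ (suc m) p (∫g (suc m) p)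
    ≡⟨ ∫-cons m p (∫g (suc m) p) ⟩
  (1ℚ - p) * ∫ m p (λ v → ∫g (suc m) p (false ∷ v)) + p * ∫ m p (λ v → ∫g (suc m) p (true ∷ v))
    ≡⟨ cong₂ (λ a b → (1ℚ - p) * a + p * b) (∫ₘ.cong ∫g-false) (trans (∫ₘ.cong ∫g-true) (∫ₘ.affine (1ℚ - p) (∫g m p) p)) ⟩
  (1ℚ - p) * ∫ m p (∫g m p) + p * ((1ℚ - p) * ∫ m p (∫g m p) + p)
    ≡⟨ ≡.cong (λ a → (1ℚ - p) * a + p * ((1ℚ - p) * a + p)) (∫∫g≡phat m p) ⟩
  (1ℚ - p) * phat m p + p * ((1ℚ - p) * phat m p + p)
    ≡⟨ recurrence p ((1ℚ - p * p) ^ m) ⟩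
  phat (suc m) p ∎
  where
  open ≡-Reasoning
  module ∫ₘ = IsExpectation (∫-isExpectation m p)
  recurrence : ∀ p X → (1ℚ - p) * (1ℚ - X) + p * ((1ℚ - p) * (1ℚ - X) + p) ≡ 1ℚ - (1ℚ - p * p) * X
  recurrence = solve-∀ ℚ-ring
  mix : ∀ p x → (1ℚ - p) * x + p * x ≡ x
  mix = solve-∀ ℚ-ring
  ∫g-false : ∀ v → ∫g (suc m) p (false ∷ v) ≡ ∫g m p v
  ∫g-false v = trans (∫-cons m p (g (false ∷ v))) (mix p (∫g m p v))
  ∫g-true : ∀ v → ∫g (suc m) p (true ∷ v) ≡ (1ℚ - p) * ∫g m p v + p
  ∫g-true v = trans (∫-cons m p (g (true ∷ v)))
                    (≡.cong (λ a → (1ℚ - p) * ∫g m p v + a) (trans (≡.cong (p *_) (∫-one m p)) (ℚ.*-identityʳ p)))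

phat-bounds : ∀ m p → 1 ℕ.≤ m → 0ℚ < p → p < 1ℚ → 0ℚ < phat m p × 0ℚ < 1ℚ - phat m p
phat-bounds (suc m) p _ p>0 p<1 = p<q⇒0<q-p X<1 , subst (0ℚ <_) (sym (1-[1-x]≡x X)) (^-pos (suc m) r>0)
  where
  r X : ℚ
  r = 1ℚ - p * p
  X = r ^ suc m
  1-p²≡[1-p][1+p] : ∀ p → 1ℚ - p * p ≡ (1ℚ - p) * (1ℚ + p)
  1-p²≡[1-p][1+p] = solve-∀ ℚ-ring
  1-[1-x]≡x : ∀ x → 1ℚ - (1ℚ - x) ≡ x
  1-[1-x]≡x = solve-∀ ℚ-ring
  r>0 : 0ℚ < r
  r>0 = subst (0ℚ <_) (sym (1-p²≡[1-p][1+p] p)) (*-pos (p<q⇒0<q-p p<1) (ℚ.+-mono-< (ℚ.positive⁻¹ 1ℚ) p>0))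
  r<1 : r < 1ℚ
  r<1 = <-by-difference (p * p) (1-[1-x]≡x (p * p)) (*-pos p>0 p>0)
  X≤r : X ≤ r
  X≤r = ℚ.≤-trans (ℚ.*-monoˡ-≤-nonNeg r {{nonNegative (ℚ.<⇒≤ r>0)}} (^≤1 m (ℚ.<⇒≤ r>0) (ℚ.<⇒≤ r<1)))
                  (ℚ.≤-reflexive (ℚ.*-identityʳ r))
  X<1 : X < 1ℚ
  X<1 = ℚ.≤-<-trans X≤r r<1

module _ (m : ℕ) (p : ℚ) where
  private
    module ∫ₘ = IsExpectation (∫-isExpectation m p)
    p̂ c : ℚ
    p̂ = phat m p
    c = 1ℚ - (p̂ + p̂)

  σ² : ℚ
  σ² = ∫ₘ.Var (∫g m p)

  σ²≡ : σ² ≡ ∫ m p (λ y → ∫g m p y * ∫g m p y) - p̂ * p̂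
  σ²≡ = ≡.cong (λ a → ∫ m p (λ y → ∫g m p y * ∫g m p y) - a * a) (∫∫g≡phat m p)

  gbar2-sq : ∀ x y → gbar2 m p x y * gbar2 m p x y ≡ c * g x y + p̂ * p̂
  gbar2-sq x y = boolℚ-sub-sq (share x y) p̂

  ∫-affine-g : ∀ x → ∫ m p (λ y → c * g x y + p̂ * p̂) ≡ c * ∫g m p x + p̂ * p̂
  ∫-affine-g x = ∫ₘ.affine c (g x) (p̂ * p̂)

  ∫-affine-∫g : ∫ m p (λ x → c * ∫g m p x + p̂ * p̂) ≡ p̂ * (1ℚ - p̂)
  ∫-affine-∫g = trans (∫ₘ.affine c (∫g m p) (p̂ * p̂)) (trans (≡.cong (λ a → c * a + p̂ * p̂) (∫∫g≡phat m p)) (edge-var p̂))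
    where
    edge-var : ∀ a → (1ℚ - (a + a)) * a + a * a ≡ a * (1ℚ - a)
    edge-var = solve-∀ ℚ-ring

  contr21-affine : ∀ y → contr21 m p y ≡ c * ∫g m p y + p̂ * p̂
  contr21-affine y = trans (∫ₘ.cong (λ w → trans (gbar2-sq w y) (≡.cong (λ a → c * a + p̂ * p̂) (g-sym w y)))) (∫-affine-g y)

  normSq21≡ : normSq21 m p ≡ (p̂ * (1ℚ - p̂)) * (p̂ * (1ℚ - p̂)) + (c * c) * σ²
  normSq21≡ = begin
    ∫ m p (λ y → contr21 m p y * contr21 m p y)
      ≡⟨ ∫ₘ.cong (λ y → cong₂ _*_ (contr21-affine y) (contr21-affine y)) ⟩
    ∫ m p (λ y → (c * q y + a) * (c * q y + a))
      ≡⟨ ∫ₘ.*-shift (λ y → c * q y) (λ y → c * q y) a a ⟩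
    ∫ m p (λ y → (c * q y) * (c * q y)) + (∫ m p (λ y → c * q y) * a + (∫ m p (λ y → c * q y) * a + a * a))
      ≡⟨ cong₂ (λ u v → u + (v * a + (v * a + a * a)))
               (trans (∫ₘ.cong (λ y → square-* c (q y))) (∫ₘ.*-hom (c * c) (λ y → q y * q y)))
               (trans (∫ₘ.*-hom c q) (≡.cong (c *_) (∫∫g≡phat m p))) ⟩
    (c * c) * t + ((c * p̂) * a + ((c * p̂) * a + a * a))
      ≡⟨ regroup p̂ t ⟩
    (p̂ * (1ℚ - p̂)) * (p̂ * (1ℚ - p̂)) + (c * c) * (t - p̂ * p̂)
      ≡⟨ ≡.cong (λ v → (p̂ * (1ℚ - p̂)) * (p̂ * (1ℚ - p̂)) + (c * c) * v) (sym σ²≡) ⟩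
    (p̂ * (1ℚ - p̂)) * (p̂ * (1ℚ - p̂)) + (c * c) * σ² ∎
    where
    open ≡-Reasoning
    q : Vec Bool m → ℚ
    q = ∫g m p
    a t : ℚ
    a = p̂ * p̂
    t = ∫ m p (λ y → q y * q y)
    square-* : ∀ c x → (c * x) * (c * x) ≡ (c * c) * (x * x)
    square-* = solve-∀ ℚ-ring
    regroup : ∀ p̂ t → let c = 1ℚ - (p̂ + p̂) ; a = p̂ * p̂ in
      (c * c) * t + ((c * p̂) * a + ((c * p̂) * a + a * a)) ≡ (p̂ * (1ℚ - p̂)) * (p̂ * (1ℚ - p̂)) + (c * c) * (t - p̂ * p̂)
    regroup = solve-∀ ℚ-ring

  module _ (p≥0 : 0ℚ ≤ p) (1-p≥0 : 0ℚ ≤ 1ℚ - p) where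

    σ²-nonNeg : 0ℚ ≤ σ²
    σ²-nonNeg = begin
      0ℚ                                   ≡⟨ sym (∫ₘ.const 0ℚ) ⟩
      ∫ m p (λ _ → 0ℚ)                     ≤⟨ ∫-mono m p≥0 1-p≥0 (λ y → square-nonNeg (∫g m p y - e)) ⟩
      ∫ m p (λ y → (∫g m p y - e) * (∫g m p y - e)) ≡⟨ ∫ₘ.Var≡𝔼[f-𝔼f]² (∫g m p) ⟩
      σ² ∎
      where
      open ℚ.≤-Reasoning
      e : ℚ
      e = ∫ m p (∫g m p)

    module _ (p̂≥0 : 0ℚ ≤ p̂) (1-p̂≥0 : 0ℚ ≤ 1ℚ - p̂) where

      normSq20≤ : normSq20 m p ≤ p̂ * (1ℚ - p̂)
      normSq20≤ = begin
        normSq20 m p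
          ≤⟨ ∫-mono m p≥0 1-p≥0 (λ x → ∫-mono m p≥0 1-p≥0 (λ y → fourth≤affine x y)) ⟩
        ∫ m p (λ x → ∫ m p (λ y → c * g x y + p̂ * p̂))
          ≡⟨ ∫ₘ.cong ∫-affine-g ⟩
        ∫ m p (λ x → c * ∫g m p x + p̂ * p̂)
          ≡⟨ ∫-affine-∫g ⟩
        p̂ * (1ℚ - p̂) ∎
        where
        open ℚ.≤-Reasoning
        fourth≤affine : ∀ x y → contr20 m p x y * contr20 m p x y ≤ c * g x y + p̂ * p̂
        fourth≤affine x y = ℚ.≤-trans (boolℚ-sub⁴≤sq (share x y) p̂≥0 1-p̂≥0) (ℚ.≤-reflexive (gbar2-sq x y))

      normSq21≤ : normSq21 m p ≤ (p̂ * (1ℚ - p̂)) * (p̂ * (1ℚ - p̂)) + σ²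
      normSq21≤ = ≤-by-difference _ (trans (≡.cong (λ v → (s * s + σ²) - v) normSq21≡) (gap p̂ σ²))
                    (*-nonNeg (*-nonNeg (*-nonNeg (ℕ→ℚ-nonNeg 4) p̂≥0) 1-p̂≥0) σ²-nonNeg)
        where
        s : ℚ
        s = p̂ * (1ℚ - p̂)
        gap : ∀ p̂ v → let c = 1ℚ - (p̂ + p̂) ; s = p̂ * (1ℚ - p̂) in
          (s * s + v) - (s * s + (c * c) * v) ≡ ((ℕ→ℚ 4 * p̂) * (1ℚ - p̂)) * v
        gap = solve-∀ ℚ-ring

-- Moments of the edge count

-- Defined through foldr so that NE (x ∷ c) unfolds to Σᵥ (g x) c + NE c.
Σᵥ : ∀ {A : Set} {n} → (A → ℚ) → Vec A n → ℚ
Σᵥ F = foldr _ (λ y r → F y + r) 0ℚ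

Σᵥ-cong : ∀ {A : Set} {n} {F G : A → ℚ} → (∀ y → F y ≡ G y) → (c : Vec A n) → Σᵥ F c ≡ Σᵥ G c
Σᵥ-cong F≗G []      = refl
Σᵥ-cong F≗G (y ∷ c) = cong₂ _+_ (F≗G y) (Σᵥ-cong F≗G c)

*-Σᵥ : ∀ {A : Set} {n} k (F : A → ℚ) (c : Vec A n) → k * Σᵥ F c ≡ Σᵥ (λ y → k * F y) c
*-Σᵥ k F []      = ℚ.*-zeroʳ k
*-Σᵥ k F (y ∷ c) = trans (ℚ.*-distribˡ-+ k (F y) (Σᵥ F c)) (≡.cong (k * F y +_) (*-Σᵥ k F c))

module _ (m : ℕ) (p : ℚ) where
  private
    module ∫ₘ = IsExpectation (∫-isExpectation m p)
    module 𝔼 n = IsExpectation (E-isExpectation n m p)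
    q : Vec Bool m → ℚ
    q = ∫g m p
    p̂ t : ℚ
    p̂ = phat m p
    t = ∫ m p (λ y → q y * q y)
    N : ℕ → ℚ
    N = ℕ→ℚ

  ∫-Σᵥ : ∀ {n} (H : Vec Bool m → Vec Bool m → ℚ) (c : Vec (Vec Bool m) n) →
    ∫ m p (λ x → Σᵥ (H x) c) ≡ Σᵥ (λ y → ∫ m p (λ x → H x y)) c
  ∫-Σᵥ H []      = ∫ₘ.const 0ℚ
  ∫-Σᵥ H (y ∷ c) = trans (∫ₘ.+-hom (λ x → H x y) (λ x → Σᵥ (H x) c)) (≡.cong (∫ m p (λ x → H x y) +_) (∫-Σᵥ H c))

  ∫-Σᵥg : ∀ {n} (c : Vec (Vec Bool m) n) → ∫ m p (λ x → Σᵥ (g x) c) ≡ Σᵥ q c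
  ∫-Σᵥg c = trans (∫-Σᵥ g c) (Σᵥ-cong (λ y → ∫ₘ.cong (λ x → g-sym x y)) c)

  E-Σᵥ : ∀ n F → E n m p (Σᵥ F) ≡ N n * ∫ m p F
  E-Σᵥ zero    F = sym (ℚ.*-zeroˡ (∫ m p F))
  E-Σᵥ (suc n) F = begin
    E (suc n) m p (Σᵥ F)                        ≡⟨ E-cons n m p (Σᵥ F) ⟩
    E n m p (λ c → ∫ m p (λ x → F x + Σᵥ F c))  ≡⟨ 𝔼.cong n (λ c → ∫ₘ.+-const F (Σᵥ F c)) ⟩
    E n m p (λ c → ∫ m p F + Σᵥ F c)            ≡⟨ 𝔼.+-hom n _ (Σᵥ F) ⟩
    E n m p (λ _ → ∫ m p F) + E n m p (Σᵥ F)    ≡⟨ cong₂ _+_ (𝔼.const n (∫ m p F)) (E-Σᵥ n F) ⟩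
    ∫ m p F + N n * ∫ m p F                     ≡⟨ ≡.cong (_+ N n * ∫ m p F) (sym (ℚ.*-identityˡ (∫ m p F))) ⟩
    1ℚ * ∫ m p F + N n * ∫ m p F                ≡⟨ sym (ℚ.*-distribʳ-+ (∫ m p F) 1ℚ (N n)) ⟩
    (1ℚ + N n) * ∫ m p F                        ≡⟨ ≡.cong (_* ∫ m p F) (sym (ℕ→ℚ-suc n)) ⟩
    N (suc n) * ∫ m p F ∎
    where open ≡-Reasoning

  E-Σᵥ² : ∀ n F G → E n m p (λ c → Σᵥ F c * Σᵥ G c)
                    ≡ N n * ∫ m p (λ x → F x * G x) + (N n * (N n - 1ℚ)) * (∫ m p F * ∫ m p G)
  E-Σᵥ² zero    F G = vanish (∫ m p (λ x → F x * G x)) (∫ m p F * ∫ m p G)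
    where
    vanish : ∀ u v → 0ℚ ≡ 0ℚ * u + (0ℚ * (0ℚ - 1ℚ)) * v
    vanish = solve-∀ ℚ-ring
  E-Σᵥ² (suc n) F G = begin
    E (suc n) m p (λ c → Σᵥ F c * Σᵥ G c)
      ≡⟨ E-cons n m p _ ⟩
    E n m p (λ c → ∫ m p (λ x → (F x + Σᵥ F c) * (G x + Σᵥ G c)))
      ≡⟨ 𝔼.cong n (λ c → ∫ₘ.*-shift F G (Σᵥ F c) (Σᵥ G c)) ⟩
    E n m p (λ c → ∫ m p FG + (∫ m p F * Σᵥ G c + (∫ m p G * Σᵥ F c + Σᵥ F c * Σᵥ G c)))
      ≡⟨ 𝔼.+-hom₄ n _ _ _ _ ⟩
    E n m p (λ _ → ∫ m p FG) + (E n m p (λ c → ∫ m p F * Σᵥ G c)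
      + (E n m p (λ c → ∫ m p G * Σᵥ F c) + E n m p (λ c → Σᵥ F c * Σᵥ G c)))
      ≡⟨ cong₂ _+_ (𝔼.const n _) (cong₂ _+_ (trans (𝔼.*-hom n (∫ m p F) (Σᵥ G)) (≡.cong (∫ m p F *_) (E-Σᵥ n G)))
                  (cong₂ _+_ (trans (𝔼.*-hom n (∫ m p G) (Σᵥ F)) (≡.cong (∫ m p G *_) (E-Σᵥ n F))) (E-Σᵥ² n F G))) ⟩
    ∫ m p FG + (∫ m p F * (N n * ∫ m p G) + (∫ m p G * (N n * ∫ m p F)
      + (N n * ∫ m p FG + (N n * (N n - 1ℚ)) * (∫ m p F * ∫ m p G))))
      ≡⟨ step (N n) (∫ m p FG) (∫ m p F) (∫ m p G) ⟩
    (1ℚ + N n) * ∫ m p FG + ((1ℚ + N n) * ((1ℚ + N n) - 1ℚ)) * (∫ m p F * ∫ m p G)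
      ≡⟨ ≡.cong (λ M → M * ∫ m p FG + (M * (M - 1ℚ)) * (∫ m p F * ∫ m p G)) (sym (ℕ→ℚ-suc n)) ⟩
    N (suc n) * ∫ m p FG + (N (suc n) * (N (suc n) - 1ℚ)) * (∫ m p F * ∫ m p G) ∎
    where
    open ≡-Reasoning
    FG : Vec Bool m → ℚ
    FG x = F x * G x
    step : ∀ N u a b → u + (a * (N * b) + (b * (N * a) + (N * u + (N * (N - 1ℚ)) * (a * b))))
                       ≡ (1ℚ + N) * u + ((1ℚ + N) * ((1ℚ + N) - 1ℚ)) * (a * b)
    step = solve-∀ ℚ-ring

  E-NE : ∀ n → E n m p NE ≡ (½ * (N n * (N n - 1ℚ))) * p̂
  E-NE zero    = sym (ℚ.*-zeroˡ p̂)
  E-NE (suc n) = begin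
    E (suc n) m p NE
      ≡⟨ E-cons n m p NE ⟩
    E n m p (λ c → ∫ m p (λ x → Σᵥ (g x) c + NE c))
      ≡⟨ 𝔼.cong n (λ c → trans (∫ₘ.+-const _ (NE c)) (≡.cong (_+ NE c) (∫-Σᵥg c))) ⟩
    E n m p (λ c → Σᵥ q c + NE c)
      ≡⟨ 𝔼.+-hom n (Σᵥ q) NE ⟩
    E n m p (Σᵥ q) + E n m p NE
      ≡⟨ cong₂ _+_ (trans (E-Σᵥ n q) (≡.cong (N n *_) (∫∫g≡phat m p))) (E-NE n) ⟩
    N n * p̂ + (½ * (N n * (N n - 1ℚ))) * p̂
      ≡⟨ step (N n) p̂ ⟩
    (½ * ((1ℚ + N n) * ((1ℚ + N n) - 1ℚ))) * p̂
      ≡⟨ ≡.cong (λ M → (½ * (M * (M - 1ℚ))) * p̂) (sym (ℕ→ℚ-suc n)) ⟩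
    (½ * (N (suc n) * (N (suc n) - 1ℚ))) * p̂ ∎
    where
    open ≡-Reasoning
    step : ∀ N a → N * a + (½ * (N * (N - 1ℚ))) * a ≡ (½ * ((1ℚ + N) * ((1ℚ + N) - 1ℚ))) * a
    step = solve-∀ ℚ-ring

  E-Σᵥ·NE : ∀ n F → E n m p (λ c → Σᵥ F c * NE c)
                    ≡ (N n * (N n - 1ℚ)) * ∫ m p (λ x → F x * q x)
                      + (½ * ((N n * (N n - 1ℚ)) * (N n - ℕ→ℚ 2))) * (∫ m p F * p̂)
  E-Σᵥ·NE zero    F = vanish (∫ m p (λ x → F x * q x)) (∫ m p F * p̂)
    where
    vanish : ∀ u v → 0ℚ ≡ (0ℚ * (0ℚ - 1ℚ)) * u + (½ * ((0ℚ * (0ℚ - 1ℚ)) * (0ℚ - ℕ→ℚ 2))) * v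
    vanish = solve-∀ ℚ-ring
  E-Σᵥ·NE (suc n) F = begin
    E (suc n) m p (λ c → Σᵥ F c * NE c)
      ≡⟨ E-cons n m p _ ⟩
    E n m p (λ c → ∫ m p (λ x → (F x + Σᵥ F c) * (Σᵥ (g x) c + NE c)))
      ≡⟨ 𝔼.cong n integrate-new-vertex ⟩
    E n m p (λ c → Σᵥ Φ c + (∫ m p F * NE c + (Σᵥ F c * Σᵥ q c + Σᵥ F c * NE c)))
      ≡⟨ 𝔼.+-hom₄ n _ _ _ _ ⟩
    E n m p (Σᵥ Φ) + (E n m p (λ c → ∫ m p F * NE c)
      + (E n m p (λ c → Σᵥ F c * Σᵥ q c) + E n m p (λ c → Σᵥ F c * NE c)))
      ≡⟨ cong₂ _+_ (trans (E-Σᵥ n Φ) (≡.cong (N n *_) ∫Φ≡u))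
           (cong₂ _+_ (trans (𝔼.*-hom n (∫ m p F) NE) (≡.cong (∫ m p F *_) (E-NE n)))
             (cong₂ _+_ (trans (E-Σᵥ² n F q) (≡.cong (λ a → N n * u + (N n * (N n - 1ℚ)) * (∫ m p F * a)) (∫∫g≡phat m p)))
               (E-Σᵥ·NE n F))) ⟩
    N n * u + (∫ m p F * ((½ * (N n * (N n - 1ℚ))) * p̂)
      + ((N n * u + (N n * (N n - 1ℚ)) * (∫ m p F * p̂))
        + ((N n * (N n - 1ℚ)) * u + (½ * ((N n * (N n - 1ℚ)) * (N n - ℕ→ℚ 2))) * (∫ m p F * p̂))))
      ≡⟨ step (N n) u (∫ m p F) p̂ ⟩
    ((1ℚ + N n) * ((1ℚ + N n) - 1ℚ)) * u
      + (½ * (((1ℚ + N n) * ((1ℚ + N n) - 1ℚ)) * ((1ℚ + N n) - ℕ→ℚ 2))) * (∫ m p F * p̂)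
      ≡⟨ ≡.cong (λ M → (M * (M - 1ℚ)) * u + (½ * ((M * (M - 1ℚ)) * (M - ℕ→ℚ 2))) * (∫ m p F * p̂)) (sym (ℕ→ℚ-suc n)) ⟩
    (N (suc n) * (N (suc n) - 1ℚ)) * u
      + (½ * ((N (suc n) * (N (suc n) - 1ℚ)) * (N (suc n) - ℕ→ℚ 2))) * (∫ m p F * p̂) ∎
    where
    open ≡-Reasoning
    u : ℚ
    u = ∫ m p (λ x → F x * q x)
    Φ : Vec Bool m → ℚ
    Φ y = ∫ m p (λ x → F x * g x y)
    ∫Φ≡u : ∫ m p Φ ≡ u
    ∫Φ≡u = trans (sym (wsum-swap (cube m) (μ m p) (cube m) (μ m p) (λ x y → F x * g x y)))
                 (∫ₘ.cong (λ x → ∫ₘ.*-hom (F x) (g x)))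
    integrate-new-vertex : ∀ c → ∫ m p (λ x → (F x + Σᵥ F c) * (Σᵥ (g x) c + NE c))
                               ≡ Σᵥ Φ c + (∫ m p F * NE c + (Σᵥ F c * Σᵥ q c + Σᵥ F c * NE c))
    integrate-new-vertex c =
      trans (∫ₘ.*-shift F (λ x → Σᵥ (g x) c) (Σᵥ F c) (NE c))
            (cong₂ _+_ (trans (∫ₘ.cong (λ x → *-Σᵥ (F x) (g x) c)) (∫-Σᵥ (λ x y → F x * g x y) c))
                       (≡.cong (λ a → ∫ m p F * NE c + (a + Σᵥ F c * NE c))
                               (trans (≡.cong (_* Σᵥ F c) (∫-Σᵥg c)) (ℚ.*-comm (Σᵥ q c) (Σᵥ F c)))))
    step : ∀ N u f a →
      N * u + (f * ((½ * (N * (N - 1ℚ))) * a)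
        + ((N * u + (N * (N - 1ℚ)) * (f * a)) + ((N * (N - 1ℚ)) * u + (½ * ((N * (N - 1ℚ)) * (N - ℕ→ℚ 2))) * (f * a))))
      ≡ ((1ℚ + N) * ((1ℚ + N) - 1ℚ)) * u + (½ * (((1ℚ + N) * ((1ℚ + N) - 1ℚ)) * ((1ℚ + N) - ℕ→ℚ 2))) * (f * a)
    step = solve-∀ ℚ-ring

  E-∫Σᵥg² : ∀ n → E n m p (λ c → ∫ m p (λ x → Σᵥ (g x) c * Σᵥ (g x) c)) ≡ N n * p̂ + (N n * (N n - 1ℚ)) * t
  E-∫Σᵥg² n = begin
    E n m p (λ c → ∫ m p (λ x → Σᵥ (g x) c * Σᵥ (g x) c))
      ≡⟨ wsum-swap (configs n m) (prob n m p) (cube m) (μ m p) (λ c x → Σᵥ (g x) c * Σᵥ (g x) c) ⟩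
    ∫ m p (λ x → E n m p (λ c → Σᵥ (g x) c * Σᵥ (g x) c))
      ≡⟨ ∫ₘ.cong (λ x → trans (E-Σᵥ² n (g x) (g x))
                              (≡.cong (λ a → N n * a + (N n * (N n - 1ℚ)) * (q x * q x)) (∫ₘ.cong (λ y → boolℚ-idem (share x y))))) ⟩
    ∫ m p (λ x → N n * q x + (N n * (N n - 1ℚ)) * (q x * q x))
      ≡⟨ ∫ₘ.+-hom _ _ ⟩
    ∫ m p (λ x → N n * q x) + ∫ m p (λ x → (N n * (N n - 1ℚ)) * (q x * q x))
      ≡⟨ cong₂ _+_ (trans (∫ₘ.*-hom (N n) q) (≡.cong (N n *_) (∫∫g≡phat m p))) (∫ₘ.*-hom (N n * (N n - 1ℚ)) (λ x → q x * q x)) ⟩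
    N n * p̂ + (N n * (N n - 1ℚ)) * t ∎
    where open ≡-Reasoning

  E-Σᵥ∫g·NE : ∀ n → E n m p (λ c → Σᵥ q c * NE c)
                    ≡ (N n * (N n - 1ℚ)) * t + (½ * ((N n * (N n - 1ℚ)) * (N n - ℕ→ℚ 2))) * (p̂ * p̂)
  E-Σᵥ∫g·NE n = trans (E-Σᵥ·NE n q)
    (≡.cong (λ a → (N n * (N n - 1ℚ)) * t + (½ * ((N n * (N n - 1ℚ)) * (N n - ℕ→ℚ 2))) * (a * p̂)) (∫∫g≡phat m p))

  E-NE² : ∀ n → E n m p (λ c → NE c * NE c)
                ≡ (½ * (N n * (N n - 1ℚ))) * p̂ + ((N n * (N n - 1ℚ)) * (N n - ℕ→ℚ 2)) * t
                  + ((½ * ½) * (((N n * (N n - 1ℚ)) * (N n - ℕ→ℚ 2)) * (N n - ℕ→ℚ 3))) * (p̂ * p̂)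
  E-NE² zero    = vanish p̂ t
    where
    vanish : ∀ a t → 0ℚ ≡ (½ * (0ℚ * (0ℚ - 1ℚ))) * a + ((0ℚ * (0ℚ - 1ℚ)) * (0ℚ - ℕ→ℚ 2)) * t
                          + ((½ * ½) * (((0ℚ * (0ℚ - 1ℚ)) * (0ℚ - ℕ→ℚ 2)) * (0ℚ - ℕ→ℚ 3))) * (a * a)
    vanish = solve-∀ ℚ-ring
  E-NE² (suc n) = begin
    E (suc n) m p (λ c → NE c * NE c)
      ≡⟨ E-cons n m p _ ⟩
    E n m p (λ c → ∫ m p (λ x → (Σᵥ (g x) c + NE c) * (Σᵥ (g x) c + NE c)))
      ≡⟨ 𝔼.cong n integrate-new-vertex ⟩
    E n m p (λ c → Y c + (Σᵥ q c * NE c + (Σᵥ q c * NE c + NE c * NE c)))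
      ≡⟨ 𝔼.+-hom₄ n _ _ _ _ ⟩
    E n m p Y + (E n m p (λ c → Σᵥ q c * NE c) + (E n m p (λ c → Σᵥ q c * NE c) + E n m p (λ c → NE c * NE c)))
      ≡⟨ cong₂ _+_ (E-∫Σᵥg² n) (cong₂ _+_ (E-Σᵥ∫g·NE n) (cong₂ _+_ (E-Σᵥ∫g·NE n) (E-NE² n))) ⟩
    (N n * p̂ + (N n * (N n - 1ℚ)) * t) + (X + (X + ((½ * (N n * (N n - 1ℚ))) * p̂
      + ((N n * (N n - 1ℚ)) * (N n - ℕ→ℚ 2)) * t
      + ((½ * ½) * (((N n * (N n - 1ℚ)) * (N n - ℕ→ℚ 2)) * (N n - ℕ→ℚ 3))) * (p̂ * p̂))))
      ≡⟨ step (N n) p̂ t ⟩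
    (½ * ((1ℚ + N n) * ((1ℚ + N n) - 1ℚ))) * p̂ + (((1ℚ + N n) * ((1ℚ + N n) - 1ℚ)) * ((1ℚ + N n) - ℕ→ℚ 2)) * t
      + ((½ * ½) * ((((1ℚ + N n) * ((1ℚ + N n) - 1ℚ)) * ((1ℚ + N n) - ℕ→ℚ 2)) * ((1ℚ + N n) - ℕ→ℚ 3))) * (p̂ * p̂)
      ≡⟨ ≡.cong (λ M → (½ * (M * (M - 1ℚ))) * p̂ + ((M * (M - 1ℚ)) * (M - ℕ→ℚ 2)) * t
                        + ((½ * ½) * (((M * (M - 1ℚ)) * (M - ℕ→ℚ 2)) * (M - ℕ→ℚ 3))) * (p̂ * p̂)) (sym (ℕ→ℚ-suc n)) ⟩
    (½ * (N (suc n) * (N (suc n) - 1ℚ))) * p̂ + ((N (suc n) * (N (suc n) - 1ℚ)) * (N (suc n) - ℕ→ℚ 2)) * t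
      + ((½ * ½) * (((N (suc n) * (N (suc n) - 1ℚ)) * (N (suc n) - ℕ→ℚ 2)) * (N (suc n) - ℕ→ℚ 3))) * (p̂ * p̂) ∎
    where
    open ≡-Reasoning
    Y : Vec (Vec Bool m) n → ℚ
    Y c = ∫ m p (λ x → Σᵥ (g x) c * Σᵥ (g x) c)
    X : ℚ
    X = (N n * (N n - 1ℚ)) * t + (½ * ((N n * (N n - 1ℚ)) * (N n - ℕ→ℚ 2))) * (p̂ * p̂)
    integrate-new-vertex : ∀ c → ∫ m p (λ x → (Σᵥ (g x) c + NE c) * (Σᵥ (g x) c + NE c))
                               ≡ Y c + (Σᵥ q c * NE c + (Σᵥ q c * NE c + NE c * NE c))
    integrate-new-vertex c =
      trans (∫ₘ.*-shift (λ x → Σᵥ (g x) c) (λ x → Σᵥ (g x) c) (NE c) (NE c))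
            (≡.cong (λ a → Y c + (a * NE c + (a * NE c + NE c * NE c))) (∫-Σᵥg c))
    step : ∀ N a t →
      (N * a + (N * (N - 1ℚ)) * t)
        + (((N * (N - 1ℚ)) * t + (½ * ((N * (N - 1ℚ)) * (N - ℕ→ℚ 2))) * (a * a))
          + (((N * (N - 1ℚ)) * t + (½ * ((N * (N - 1ℚ)) * (N - ℕ→ℚ 2))) * (a * a))
            + ((½ * (N * (N - 1ℚ))) * a + ((N * (N - 1ℚ)) * (N - ℕ→ℚ 2)) * t
               + ((½ * ½) * (((N * (N - 1ℚ)) * (N - ℕ→ℚ 2)) * (N - ℕ→ℚ 3))) * (a * a))))
      ≡ (½ * ((1ℚ + N) * ((1ℚ + N) - 1ℚ))) * a + (((1ℚ + N) * ((1ℚ + N) - 1ℚ)) * ((1ℚ + N) - ℕ→ℚ 2)) * t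
        + ((½ * ½) * ((((1ℚ + N) * ((1ℚ + N) - 1ℚ)) * ((1ℚ + N) - ℕ→ℚ 2)) * ((1ℚ + N) - ℕ→ℚ 3))) * (a * a)
    step = solve-∀ ℚ-ring

  VarNE≡ : ∀ n → VarNE n m p ≡ (½ * (N n * (N n - 1ℚ))) * (p̂ * (1ℚ - p̂)) + ((N n * (N n - 1ℚ)) * (N n - ℕ→ℚ 2)) * σ² m p
  VarNE≡ n = begin
    VarNE n m p
      ≡⟨ cong₂ (λ a b → a - b * b) (E-NE² n) (E-NE n) ⟩
    (½ * (N n * (N n - 1ℚ))) * p̂ + ((N n * (N n - 1ℚ)) * (N n - ℕ→ℚ 2)) * t
      + ((½ * ½) * (((N n * (N n - 1ℚ)) * (N n - ℕ→ℚ 2)) * (N n - ℕ→ℚ 3))) * (p̂ * p̂)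
      - ((½ * (N n * (N n - 1ℚ))) * p̂) * ((½ * (N n * (N n - 1ℚ))) * p̂)
      ≡⟨ centre (N n) p̂ t ⟩
    (½ * (N n * (N n - 1ℚ))) * (p̂ * (1ℚ - p̂)) + ((N n * (N n - 1ℚ)) * (N n - ℕ→ℚ 2)) * (t - p̂ * p̂)
      ≡⟨ ≡.cong (λ v → (½ * (N n * (N n - 1ℚ))) * (p̂ * (1ℚ - p̂)) + ((N n * (N n - 1ℚ)) * (N n - ℕ→ℚ 2)) * v) (sym (σ²≡ m p)) ⟩
    (½ * (N n * (N n - 1ℚ))) * (p̂ * (1ℚ - p̂)) + ((N n * (N n - 1ℚ)) * (N n - ℕ→ℚ 2)) * σ² m p ∎
    where
    open ≡-Reasoning
    centre : ∀ N a t →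
      (½ * (N * (N - 1ℚ))) * a + ((N * (N - 1ℚ)) * (N - ℕ→ℚ 2)) * t
        + ((½ * ½) * (((N * (N - 1ℚ)) * (N - ℕ→ℚ 2)) * (N - ℕ→ℚ 3))) * (a * a)
        - ((½ * (N * (N - 1ℚ))) * a) * ((½ * (N * (N - 1ℚ))) * a)
      ≡ (½ * (N * (N - 1ℚ))) * (a * (1ℚ - a)) + ((N * (N - 1ℚ)) * (N - ℕ→ℚ 2)) * (t - a * a)
    centre = solve-∀ ℚ-ring

-- The estimates

variance-lower-bounds : ∀ {N V s w} d → 0ℚ ≤ d → 0ℚ ≤ s → 0ℚ ≤ w → N ≡ ℕ→ℚ 3 + d →
  V ≡ (½ * (N * (N - 1ℚ))) * s + ((N * (N - 1ℚ)) * (N - ℕ→ℚ 2)) * w →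
  (N * N) * s ≤ ℕ→ℚ 3 * V × ((N * N) * N) * w ≤ (ℤ.+ 9 / 2) * V
variance-lower-bounds d d≥0 s≥0 w≥0 refl refl =
  ≤-by-difference _ (gap₃ d _ _)
    (+-nonNeg (*-nonNeg (*-nonNeg ½≥0 (*-nonNeg (k+d≥0 3) d≥0)) s≥0)
              (*-nonNeg (*-nonNeg (ℕ→ℚ-nonNeg 3) (*-nonNeg (*-nonNeg (k+d≥0 3) (k+d≥0 2)) (k+d≥0 1))) w≥0)) ,
  ≤-by-difference _ (gap₉/₂ d _ _)
    (+-nonNeg (*-nonNeg (*-nonNeg (ℚ.nonNegative⁻¹ (ℤ.+ 9 / 4)) (*-nonNeg (k+d≥0 3) (k+d≥0 2))) s≥0)
              (*-nonNeg (*-nonNeg ½≥0 (*-nonNeg (*-nonNeg (k+d≥0 3) d≥0) 15+7d≥0)) w≥0))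
  where
  ½≥0 : 0ℚ ≤ ½
  ½≥0 = ℚ.nonNegative⁻¹ ½
  k+d≥0 : ∀ k → 0ℚ ≤ ℕ→ℚ k + d
  k+d≥0 k = +-nonNeg (ℕ→ℚ-nonNeg k) d≥0
  15+7d≥0 : 0ℚ ≤ ℕ→ℚ 15 + ℕ→ℚ 7 * d
  15+7d≥0 = +-nonNeg (ℕ→ℚ-nonNeg 15) (*-nonNeg (ℕ→ℚ-nonNeg 7) d≥0)
  gap₃ : ∀ d s w → let N = ℕ→ℚ 3 + d in
    ℕ→ℚ 3 * ((½ * (N * (N - 1ℚ))) * s + ((N * (N - 1ℚ)) * (N - ℕ→ℚ 2)) * w) - (N * N) * s
    ≡ (½ * ((ℕ→ℚ 3 + d) * d)) * s + (ℕ→ℚ 3 * (((ℕ→ℚ 3 + d) * (ℕ→ℚ 2 + d)) * (ℕ→ℚ 1 + d))) * w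
  gap₃ = solve-∀ ℚ-ring
  gap₉/₂ : ∀ d s w → let N = ℕ→ℚ 3 + d in
    (ℤ.+ 9 / 2) * ((½ * (N * (N - 1ℚ))) * s + ((N * (N - 1ℚ)) * (N - ℕ→ℚ 2)) * w) - ((N * N) * N) * w
    ≡ ((ℤ.+ 9 / 4) * ((ℕ→ℚ 3 + d) * (ℕ→ℚ 2 + d))) * s + (½ * (((ℕ→ℚ 3 + d) * d) * (ℕ→ℚ 15 + ℕ→ℚ 7 * d))) * w
  gap₉/₂ = solve-∀ ℚ-ring

C : ℚ
C = ℤ.+ 27 / 2

module _ (n m : ℕ) (p : ℚ) (n≥3 : 3 ℕ.≤ n) (m≥1 : 1 ℕ.≤ m) (p>0 : 0ℚ < p) (p<1 : p < 1ℚ) where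
  private
    N p̂ s V Z X Y : ℚ
    N = ℕ→ℚ n
    p̂ = phat m p
    s = p̂ * (1ℚ - p̂)
    V = VarNE n m p
    Z = (ℕ→ℚ n ^ 2) * phat m p * (1ℚ - phat m p)
    X = (N * N) * s
    Y = ((N * N) * N) * σ² m p

    p≥0 : 0ℚ ≤ p
    p≥0 = ℚ.<⇒≤ p>0
    1-p≥0 : 0ℚ ≤ 1ℚ - p
    1-p≥0 = ℚ.<⇒≤ (p<q⇒0<q-p p<1)
    p̂≥0 : 0ℚ ≤ p̂
    p̂≥0 = ℚ.<⇒≤ (proj₁ (phat-bounds m p m≥1 p>0 p<1))
    1-p̂≥0 : 0ℚ ≤ 1ℚ - p̂
    1-p̂≥0 = ℚ.<⇒≤ (proj₂ (phat-bounds m p m≥1 p>0 p<1))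
    s>0 : 0ℚ < s
    s>0 = *-pos (proj₁ (phat-bounds m p m≥1 p>0 p<1)) (proj₂ (phat-bounds m p m≥1 p>0 p<1))

    N≡3+d : N ≡ ℕ→ℚ 3 + ℕ→ℚ (n ℕ.∸ 3)
    N≡3+d = trans (≡.cong ℕ→ℚ (sym (ℕ.m+[n∸m]≡n n≥3))) (ℕ→ℚ-+ 3 (n ℕ.∸ 3))
    N>0 : 0ℚ < N
    N>0 = subst (0ℚ <_) (sym N≡3+d) (ℚ.+-mono-<-≤ (ℚ.positive⁻¹ (ℕ→ℚ 3)) (ℕ→ℚ-nonNeg (n ℕ.∸ 3)))
    N≥0 : 0ℚ ≤ N
    N≥0 = ℚ.<⇒≤ N>0

    Z≡X : Z ≡ X
    Z≡X = reassoc N p̂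
      where
      reassoc : ∀ N a → (N * (N * 1ℚ)) * a * (1ℚ - a) ≡ (N * N) * (a * (1ℚ - a))
      reassoc = solve-∀ ℚ-ring
    Z>0 : 0ℚ < Z
    Z>0 = subst (0ℚ <_) (sym Z≡X) (*-pos (*-pos N>0 N>0) s>0)

    X≤3V×Y≤9V/2 : X ≤ ℕ→ℚ 3 * V × Y ≤ (ℤ.+ 9 / 2) * V
    X≤3V×Y≤9V/2 = variance-lower-bounds (ℕ→ℚ (n ℕ.∸ 3)) (ℕ→ℚ-nonNeg (n ℕ.∸ 3)) (ℚ.<⇒≤ s>0) (σ²-nonNeg m p p≥0 1-p≥0)
                                        N≡3+d (VarNE≡ m p n)
    X≤3V : X ≤ ℕ→ℚ 3 * V
    X≤3V = proj₁ X≤3V×Y≤9V/2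
    Y≤9V/2 : Y ≤ (ℤ.+ 9 / 2) * V
    Y≤9V/2 = proj₂ X≤3V×Y≤9V/2
    X≥0 : 0ℚ ≤ X
    X≥0 = *-nonNeg (*-nonNeg N≥0 N≥0) (ℚ.<⇒≤ s>0)
    Y≥0 : 0ℚ ≤ Y
    Y≥0 = *-nonNeg (*-nonNeg (*-nonNeg N≥0 N≥0) N≥0) (σ²-nonNeg m p p≥0 1-p≥0)

    X²≤CV² : X * X ≤ C * (V ^ 2)
    X²≤CV² = ℚ.≤-trans (*-mono-≤-nonNeg X≥0 X≤3V X≥0 X≤3V)
                       (≤-by-difference _ (gap V) (*-nonNeg (ℚ.nonNegative⁻¹ (ℤ.+ 9 / 2)) (square-nonNeg V)))
      where
      gap : ∀ V → C * (V * (V * 1ℚ)) - (ℕ→ℚ 3 * V) * (ℕ→ℚ 3 * V) ≡ (ℤ.+ 9 / 2) * (V * V)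
      gap = solve-∀ ℚ-ring

    YX≤CV² : Y * X ≤ C * (V ^ 2)
    YX≤CV² = ℚ.≤-trans (*-mono-≤-nonNeg Y≥0 Y≤9V/2 X≥0 X≤3V) (ℚ.≤-reflexive (regroup V))
      where
      regroup : ∀ V → ((ℤ.+ 9 / 2) * V) * (ℕ→ℚ 3 * V) ≡ C * (V * (V * 1ℚ))
      regroup = solve-∀ ℚ-ring

  normSq20-bound : (ℕ→ℚ n ^ 2) * normSq20 m p ≤ C * ((VarNE n m p ^ 2) * inv ((ℕ→ℚ n ^ 2) * phat m p * (1ℚ - phat m p)))
  normSq20-bound = begin
    (ℕ→ℚ n ^ 2) * normSq20 m p
      ≤⟨ ℚ.*-monoˡ-≤-nonNeg (ℕ→ℚ n ^ 2) {{nonNegative (^-nonNeg 2 N≥0)}} (normSq20≤ m p p≥0 1-p≥0 p̂≥0 1-p̂≥0) ⟩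
    (ℕ→ℚ n ^ 2) * s
      ≡⟨ reassoc N s ⟩
    X
      ≤⟨ *≤⇒≤*inv Z>0 (subst (λ z → X * z ≤ C * (V ^ 2)) (sym Z≡X) X²≤CV²) ⟩
    (C * (V ^ 2)) * inv Z
      ≡⟨ ℚ.*-assoc C (V ^ 2) (inv Z) ⟩
    C * ((V ^ 2) * inv Z) ∎
    where
    open ℚ.≤-Reasoning
    reassoc : ∀ N s → (N * (N * 1ℚ)) * s ≡ (N * N) * s
    reassoc = solve-∀ ℚ-ring

  normSq21-bound : (ℕ→ℚ n ^ 3) * normSq21 m p
                   ≤ C * ((VarNE n m p ^ 2) * (inv ((ℕ→ℚ n ^ 2) * phat m p * (1ℚ - phat m p)) + inv (ℕ→ℚ n)))
  normSq21-bound = begin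
    (ℕ→ℚ n ^ 3) * normSq21 m p
      ≤⟨ ℚ.*-monoˡ-≤-nonNeg (ℕ→ℚ n ^ 3) {{nonNegative (^-nonNeg 3 N≥0)}} (normSq21≤ m p p≥0 1-p≥0 p̂≥0 1-p̂≥0) ⟩
    (ℕ→ℚ n ^ 3) * (s * s + σ² m p)
      ≡⟨ ℚ.*-distribˡ-+ (ℕ→ℚ n ^ 3) (s * s) (σ² m p) ⟩
    (ℕ→ℚ n ^ 3) * (s * s) + (ℕ→ℚ n ^ 3) * σ² m p
      ≤⟨ ℚ.+-mono-≤ mean-part variance-part ⟩
    (C * (V ^ 2)) * inv N + (C * (V ^ 2)) * inv Z
      ≡⟨ collect C (V ^ 2) (inv N) (inv Z) ⟩
    C * ((V ^ 2) * (inv Z + inv N)) ∎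
    where
    open ℚ.≤-Reasoning
    cube-s² : ∀ N s → ((N * (N * (N * 1ℚ))) * (s * s)) * N ≡ ((N * N) * s) * ((N * N) * s)
    cube-s² = solve-∀ ℚ-ring
    cube-assoc : ∀ N w → (N * (N * (N * 1ℚ))) * w ≡ ((N * N) * N) * w
    cube-assoc = solve-∀ ℚ-ring
    collect : ∀ c v a b → (c * v) * a + (c * v) * b ≡ c * (v * (b + a))
    collect = solve-∀ ℚ-ring
    mean-part : (ℕ→ℚ n ^ 3) * (s * s) ≤ (C * (V ^ 2)) * inv N
    mean-part = *≤⇒≤*inv N>0 (subst (_≤ C * (V ^ 2)) (sym (cube-s² N s)) X²≤CV²)
    variance-part : (ℕ→ℚ n ^ 3) * σ² m p ≤ (C * (V ^ 2)) * inv Z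
    variance-part = *≤⇒≤*inv Z>0 (subst (_≤ C * (V ^ 2)) (sym YZ≡YX) YX≤CV²)
      where
      YZ≡YX : ((ℕ→ℚ n ^ 3) * σ² m p) * Z ≡ Y * X
      YZ≡YX = trans (≡.cong (((ℕ→ℚ n ^ 3) * σ² m p) *_) Z≡X) (≡.cong (_* X) (cube-assoc N (σ² m p)))

lemma7p1 : Σ ℚ (λ C → (n m : ℕ) → 3 ℕ.≤ n → 3 ℕ.≤ m → (p : ℚ) → 0ℚ < p → p < 1ℚ →
    ((ℕ→ℚ n ^ 2) * normSq20 m p
        ≤ C * ((VarNE n m p ^ 2) * inv ((ℕ→ℚ n ^ 2) * phat m p * (1ℚ - phat m p))))
    × ((ℕ→ℚ n ^ 3) * normSq21 m p
        ≤ C * ((VarNE n m p ^ 2)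
                * (inv ((ℕ→ℚ n ^ 2) * phat m p * (1ℚ - phat m p)) + inv (ℕ→ℚ n)))))
lemma7p1 = C , λ n m n≥3 m≥3 p p>0 p<1 →
  let m≥1 : 1 ℕ.≤ m
      m≥1 = ℕ.≤-trans (ℕ.s≤s ℕ.z≤n) m≥3
  in normSq20-bound n m p n≥3 m≥1 p>0 p<1 , normSq21-bound n m p n≥3 m≥1 p>0 p<1
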